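{- Let $n\in\mathbb{N}$ and fix $\mathbf{y}=(y_1,y_2,\ldots,y_n)\in\mathbb{N}^n$. Then \[|\mathsf{PS}_n(\mathbf{y})|=\sum_{\sigma\in\mathfrak{S}_n}|\mathcal{O}_{\mathsf{PS}_n(\mathbf{y})}^{ -1}(\sigma)|=\sum_{\sigma\in\mathfrak{S}_n}\prod_{i=1}^n\left(1+\sum_{k\in L(\mathbf{y},\sigma_i)}y_k\right),\] where for $\sigma=\sigma_1\cdots\sigma_n\in\mathfrak{S}_n$ and $i\in[n]$, $L(\mathbf{y},\sigma_i)=\emptyset$ if $i=1$ or $\sigma_{i-1}>\sigma_i$, and otherwise $L(\mathbf{y},\sigma_i)=\{\sigma_t,\ldots,\sigma_{i-1}\}$ where $\sigma_t\sigma_{t+1}\cdots\sigma_i$ is the longest contiguous subword of $\sigma$ ending at position $i$ with $\sigma_k<\sigma_i$ for all $t\le k<i$.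
   Context: Parking sequences: there are $n$ cars $1,\ldots,n$ of lengths $y_1,\ldots,y_n\in\mathbb{N}$ and $m=\sum_i y_i$ spots labeled $1,\ldots,m$ on a one-way street. A preference list is $\mathbf{x}=(x_1,\ldots,x_n)\in[m]^n$. Cars enter in order $1,\ldots,n$; car $i$ finds the first empty spot $j\ge x_i$; if spots $j,\ldots,j+y_i-1$ are all empty it parks there, otherwise it fails to park (collision). $\mathbf{x}$ is a parking sequence for $\mathbf{y}$ if all cars park; $\mathsf{PS}_n(\mathbf{y})$ is the set of these. The outcome $\mathcal{O}_{\mathsf{PS}_n(\mathbf{y})}(\mathbf{x})=\sigma\in\mathfrak{S}_n$ is given by $\sigma_j=i$ iff car $i$ is the $j$th car from the left on the street; $\mathcal{O}_{\mathsf{PS}_n(\mathbf{y})}^{ -1}(\sigma)$ is the set of parking sequences with outcome $\sigma$. -}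

module Defs where

open import Data.Nat using (ℕ; zero; suc; _+_; _*_; _≤ᵇ_; _≡ᵇ_; _<ᵇ_)
open import Data.Bool using (Bool; true; false; not; _∧_; if_then_else_)
open import Data.List using (List; []; _∷_; map; filterᵇ; length;
  upTo; allFin; concatMap; head; takeWhileᵇ; reverse; take; mapMaybe)
open import Data.Bool.ListAction using (any; all)
open import Data.Nat.ListAction using (sum)
open import Data.Vec as V using (Vec)
open import Data.Fin as F using (Fin)
open import Data.Maybe using (Maybe; just; nothing)
open import Data.Product using (_×_; _,_; proj₁; proj₂)

-- Conventions: n cars are Fin n (car 1 ↔ F.zero, ..., car n ↔ fromℕ (n-1));
-- the order on cars is the order on Fin n.  Spots are the naturals 1,…,m.

totalLength : ∀ {n} → Vec ℕ n → ℕ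
totalLength y = V.sum y

spots : ℕ → List ℕ
spots m = map suc (upTo m)

record Street (n : ℕ) : Set where
  constructor street
  field
    occupiedSpots : List ℕ
    parked        : List (ℕ × Fin n)     -- (leftmost spot, car)
open Street public

isOccupied : ∀ {n} → Street n → ℕ → Bool
isOccupied s j = any (j ≡ᵇ_) (occupiedSpots s)

firstEmpty : ∀ {n} → ℕ → Street n → ℕ → Maybe ℕ
firstEmpty m s p = head (filterᵇ (λ j → (p ≤ᵇ j) ∧ not (isOccupied s j)) (spots m))

block : ℕ → ℕ → List ℕ
block j zero = []
block j (suc len) = j ∷ block (suc j) len

blockFree : ∀ {n} → ℕ → Street n → List ℕ → Bool
blockFree m s b = all (λ k → (k ≤ᵇ m) ∧ not (isOccupied s k)) b

parkCar : ∀ {n} → ℕ → Fin n → ℕ → ℕ → Street n → Maybe (Street n)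
parkCar m c len p s with firstEmpty m s p
... | nothing = nothing
... | just j  = if blockFree m s (block j len)
                  then just (street (block j len Data.List.++ occupiedSpots s) ((j , c) ∷ parked s))
                  else nothing

runCars : ∀ {n} → ℕ → Vec ℕ n → Vec ℕ n → List (Fin n) → Street n → Maybe (Street n)
runCars m y x [] s = just s
runCars m y x (c ∷ cs) s with parkCar m c (V.lookup y c) (V.lookup x c) s
... | nothing = nothing
... | just s' = runCars m y x cs s'

parkingProcess : ∀ {n} → Vec ℕ n → Vec ℕ n → Maybe (Street n)
parkingProcess {n} y x = runCars (totalLength y) y x (allFin n) (street [] [])

isParkingSequence : ∀ {n} → Vec ℕ n → Vec ℕ n → Bool
isParkingSequence y x with parkingProcess y x
... | nothing = false
... | just _  = true

vecsOver : ∀ {a} {A : Set a} → List A → (k : ℕ) → List (Vec A k)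
vecsOver xs zero = V.[] ∷ []
vecsOver xs (suc k) = concatMap (λ a → map (a V.∷_) (vecsOver xs k)) xs

preferenceLists : ∀ {n} → Vec ℕ n → List (Vec ℕ n)
preferenceLists {n} y = vecsOver (spots (totalLength y)) n

-- PS_n(y), as a list (without repetitions) of preference lists
PS : ∀ {n} → Vec ℕ n → List (Vec ℕ n)
PS y = filterᵇ (isParkingSequence y) (preferenceLists y)

carAt : ∀ {n} → List (ℕ × Fin n) → ℕ → Maybe (Fin n)
carAt [] j = nothing
carAt ((k , c) ∷ ps) j = if j ≡ᵇ k then just c else carAt ps j

outcomeOfStreet : ∀ {n} → ℕ → Street n → List (Fin n)
outcomeOfStreet m s = mapMaybe (carAt (parked s)) (spots m)

_≡ᶠ_ : ∀ {n} → Fin n → Fin n → Bool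
a ≡ᶠ b = F.toℕ a ≡ᵇ F.toℕ b

_<ᶠ_ : ∀ {n} → Fin n → Fin n → Bool
a <ᶠ b = F.toℕ a <ᵇ F.toℕ b

eqWord : ∀ {n} → List (Fin n) → List (Fin n) → Bool
eqWord [] [] = true
eqWord (a ∷ as) (b ∷ bs) = (a ≡ᶠ b) ∧ eqWord as bs
eqWord _ _ = false

hasOutcome : ∀ {n} → Vec ℕ n → Vec (Fin n) n → Vec ℕ n → Bool
hasOutcome y σ x with parkingProcess y x
... | nothing = false
... | just s  = eqWord (outcomeOfStreet (totalLength y) s) (V.toList σ)

outcomeFiber : ∀ {n} → Vec ℕ n → Vec (Fin n) n → List (Vec ℕ n)
outcomeFiber y σ = filterᵇ (hasOutcome y σ) (PS y)

distinct : ∀ {n} → List (Fin n) → Bool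
distinct [] = true
distinct (a ∷ as) = not (any (a ≡ᶠ_) as) ∧ distinct as

permutations : (n : ℕ) → List (Vec (Fin n) n)
permutations n = filterᵇ (λ σ → distinct (V.toList σ)) (vecsOver (allFin n) n)

-- L(y, σ_i) for position i (0-based here): the entries σ_t,…,σ_{i-1} of the
-- longest run immediately left of position i with all entries < σ_i
-- (empty if i is the first position or σ_{i-1} > σ_i).
L : ∀ {n} → List (Fin n) → ℕ → Fin n → List (Fin n)
L σ i σi = takeWhileᵇ (_<ᶠ σi) (reverse (take i σ))

weightFrom : ∀ {n} → Vec ℕ n → List (Fin n) → ℕ → List (Fin n) → ℕ
weightFrom y σ i [] = 1
weightFrom y σ i (σi ∷ rest) =
  (1 + sum (map (V.lookup y) (L σ i σi))) * weightFrom y σ (suc i) rest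

weight : ∀ {n} → Vec ℕ n → Vec (Fin n) n → ℕ
weight y σ = weightFrom y (V.toList σ) 0 (V.toList σ)

-- Record, for every car c that parks at spot b, that its block was free and inside the street,
-- that all cars parked before it are smaller, and that every spot from its preference x_c up
-- to b was already occupied.  The occupied spots are then distinct, lie in [1, m] and number m,
-- so they fill the street, and reading it from left to right yields a permutation: every
-- parking sequence has exactly one outcome, which gives the first equality.
--
-- For a fixed σ, car c can only park at firstSpot c = 1 + (total length of the cars left of c
-- in σ).  A preference list has outcome σ iff firstSpot c − w_c ≤ x_c ≤ firstSpot c for every c,
-- where w_c is the total length of L(y, c): the spots of that interval are covered by the run of
-- smaller cars immediately left of c, which parked before c, while the spot just below it belongs
-- to a larger car, which parks after c.  So the fiber of σ is a box with sides 1 + w_c.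

module Submission where

open import Defs
open import Data.Bool using (Bool; true; false; not; _∧_; if_then_else_; T)
open import Data.Bool.ListAction using (any)
open import Data.Bool.Properties using (T-∧; T-≡; T?; ∧-zeroʳ)
open import Data.Empty using (⊥-elim)
open import Data.Fin as F using (Fin; toℕ)
open import Data.Fin.Properties using (toℕ-injective)
open import Data.List
  using (List; []; _∷_; [_]; map; filterᵇ; length; _++_; concatMap; head; applyUpTo; allFin; tabulate;
         reverse; take; takeWhileᵇ; mapMaybe; _ʳ++_)
open import Data.List.Membership.Propositional using (_∈_; _∉_)
open import Data.List.Membership.Propositional.Properties
  using (∈-∃++; ∈-allFin; ∈-map⁺; ∈-map⁻; ∈-++⁺ʳ; ∈-++⁻; ∈-concat⁺′; ∈-concat⁻′; ∈-filter⁻)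
open import Data.List.Membership.Propositional.Properties.WithK using (unique∧set⇒bag)
open import Data.List.Properties
  using (length-++; map-upTo; mapMaybe-++; map-cong; map-cong-local; filter-++; filter-all; filter-none;
         map-tabulate; length-tabulate; ++-assoc; map-++; reverse-++; reverse-involutive; unfold-reverse;
         ++-identityʳ)
open import Data.List.Relation.Binary.BagAndSetEquality using (∼bag⇒↭)
open import Data.List.Relation.Binary.Permutation.Propositional using (_↭_)
open import Data.List.Relation.Binary.Permutation.Propositional.Properties as Perm using (↭-reverse)
open import Data.List.Relation.Unary.All as All using (All; []; _∷_)
open import Data.List.Relation.Unary.All.Properties using (all⁺; all⁻)
open import Data.List.Relation.Unary.AllPairs using (AllPairs; []; _∷_)
open import Data.List.Relation.Unary.AllPairs.Properties using (tabulate⁺-<)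
open import Data.List.Relation.Unary.Any as Any using (here; there)
open import Data.List.Relation.Unary.Any.Properties using (any⁺; any⁻; reverse⁺; reverse⁻)
open import Data.List.Relation.Unary.Unique.Propositional using (Unique)
import Data.List.Relation.Unary.Unique.Propositional.Properties as Unique
open import Data.Maybe using (Maybe; just; nothing)
open import Data.Nat
  using (ℕ; zero; suc; _+_; _*_; _∸_; _≟_; _≤_; _<_; z≤n; s≤s; z<s; _≡ᵇ_; _≤ᵇ_; _<ᵇ_; _≤?_; _<?_)
open import Data.Nat.ListAction using (sum; product)
open import Data.Nat.ListAction.Properties using (sum-↭; product-↭; sum-++)
open import Data.Nat.Properties
open import Data.Product using (_×_; _,_; proj₁; proj₂; ∃-syntax)
open import Data.Sum using (_⊎_; inj₁; inj₂)
open import Data.Unit using (tt)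
open import Data.Vec as V using (Vec; lookup)
open import Data.Vec.Properties using (length-toList)
open import Function using (_∘_)
open import Function.Bundles using (module Equivalence; mk⇔)
open import Relation.Binary.Definitions using (DecidableEquality; tri<; tri≈; tri>)
open import Relation.Binary.PropositionalEquality hiding ([_])
open import Relation.Nullary using (¬_; yes; no)

open Equivalence using (to; from)
open import Algebra.Properties.CommutativeSemigroup +-commutativeSemigroup using (interchange)

variable
  A B : Set

¬T⇒T-not : ∀ {b} → ¬ T b → T (not b)
¬T⇒T-not {false} _ = tt
¬T⇒T-not {true} ¬t = ¬t tt

T-not⇒¬T : ∀ {b} → T (not b) → ¬ T b
T-not⇒¬T {false} _ ()

T-any-≡ᵇ⇒∈ : ∀ {j} xs → T (any (j ≡ᵇ_) xs) → j ∈ xs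
T-any-≡ᵇ⇒∈ xs t = Any.map (≡ᵇ⇒≡ _ _) (any⁻ _ xs t)

∈⇒T-any-≡ᵇ : ∀ {j xs} → j ∈ xs → T (any (j ≡ᵇ_) xs)
∈⇒T-any-≡ᵇ {j} j∈xs = any⁺ _ (Any.map (λ { refl → ≡⇒≡ᵇ j j refl }) j∈xs)

≡ᶠ⇒≡ : ∀ {n} (c d : Fin n) → T (c ≡ᶠ d) → c ≡ d
≡ᶠ⇒≡ c d t = toℕ-injective (≡ᵇ⇒≡ (toℕ c) (toℕ d) t)

≡ᶠ-refl : ∀ {n} (c : Fin n) → T (c ≡ᶠ c)
≡ᶠ-refl c = ≡⇒≡ᵇ (toℕ c) (toℕ c) refl

≢⇒≡ᶠ-false : ∀ {n} {c d : Fin n} → c ≢ d → (c ≡ᶠ d) ≡ false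
≢⇒≡ᶠ-false {c = c} {d} c≢d with c ≡ᶠ d in eq
... | true = ⊥-elim (c≢d (≡ᶠ⇒≡ c d (from T-≡ eq)))
... | false = refl

T-any-≡ᶠ⇒∈ : ∀ {n} {c : Fin n} xs → T (any (c ≡ᶠ_) xs) → c ∈ xs
T-any-≡ᶠ⇒∈ xs t = Any.map (≡ᶠ⇒≡ _ _) (any⁻ _ xs t)

∈⇒T-any-≡ᶠ : ∀ {n} {c : Fin n} {xs} → c ∈ xs → T (any (c ≡ᶠ_) xs)
∈⇒T-any-≡ᶠ {c = c} c∈xs = any⁺ _ (Any.map (λ { refl → ≡ᶠ-refl c }) c∈xs)

T-distinct⇒Unique : ∀ {n} (xs : List (Fin n)) → T (distinct xs) → Unique xs
T-distinct⇒Unique [] _ = []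
T-distinct⇒Unique (x ∷ xs) t =
  All.tabulate (λ { d∈xs refl → T-not⇒¬T (proj₁ (to T-∧ t)) (∈⇒T-any-≡ᶠ d∈xs) })
  ∷ T-distinct⇒Unique xs (proj₂ (to T-∧ t))

Unique⇒T-distinct : ∀ {n} {xs : List (Fin n)} → Unique xs → T (distinct xs)
Unique⇒T-distinct [] = tt
Unique⇒T-distinct {xs = x ∷ xs} (x∉xs ∷ u) =
  from T-∧ (¬T⇒T-not (λ t → All.lookup x∉xs (T-any-≡ᶠ⇒∈ xs t) refl) , Unique⇒T-distinct u)

T-eqWord⇒≡ : ∀ {n} (w v : List (Fin n)) → T (eqWord w v) → w ≡ v
T-eqWord⇒≡ [] [] _ = refl
T-eqWord⇒≡ (a ∷ w) (b ∷ v) t = cong₂ _∷_ (≡ᶠ⇒≡ a b (proj₁ (to T-∧ t))) (T-eqWord⇒≡ w v (proj₂ (to T-∧ t)))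

eqWord-refl : ∀ {n} (w : List (Fin n)) → T (eqWord w w)
eqWord-refl [] = tt
eqWord-refl (a ∷ w) = from T-∧ (≡ᶠ-refl a , eqWord-refl w)

∈-remove : ∀ {z x : A} xs {ys} → z ∈ xs ++ x ∷ ys → z ≢ x → z ∈ xs ++ ys
∈-remove [] (here refl) z≢x = ⊥-elim (z≢x refl)
∈-remove [] (there z∈ys) _ = z∈ys
∈-remove (a ∷ xs) (here refl) _ = here refl
∈-remove (a ∷ xs) (there z∈) z≢x = there (∈-remove xs z∈ z≢x)

length-++-<-∷ : ∀ (xs : List A) {x ys} → length (xs ++ ys) < length (xs ++ x ∷ ys)
length-++-<-∷ [] = ≤-refl
length-++-<-∷ (_ ∷ xs) = s≤s (length-++-<-∷ xs)

unique-⊆⇒length≤ : ∀ (xs ys : List A) → Unique xs → (∀ {z} → z ∈ xs → z ∈ ys) → length xs ≤ length ys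
unique-⊆⇒length≤ [] ys _ _ = z≤n
unique-⊆⇒length≤ (x ∷ xs) ys (x∉xs ∷ u) xs⊆ys with as , bs , refl ← ∈-∃++ (xs⊆ys (here refl)) =
  ≤-trans (s≤s (unique-⊆⇒length≤ xs (as ++ bs) u xs⊆as++bs)) (length-++-<-∷ as)
  where
  xs⊆as++bs : ∀ {z} → z ∈ xs → z ∈ as ++ bs
  xs⊆as++bs z∈xs = ∈-remove as (xs⊆ys (there z∈xs)) (λ { refl → All.lookup x∉xs z∈xs refl })

module _ (_≟_ : DecidableEquality A) where
  open import Data.List.Membership.DecPropositional _≟_ using (_∈?_)

  unique-⊆-length≥⇒⊇ : ∀ (xs ys : List A) → Unique xs → (∀ {z} → z ∈ xs → z ∈ ys) →
    length ys ≤ length xs → ∀ {z} → z ∈ ys → z ∈ xs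
  unique-⊆-length≥⇒⊇ xs ys u xs⊆ys |ys|≤|xs| {z} z∈ys with z ∈? xs
  ... | yes z∈xs = z∈xs
  ... | no z∉xs with as , bs , refl ← ∈-∃++ z∈ys = ⊥-elim (<-irrefl refl (begin-strict
    length xs              ≤⟨ unique-⊆⇒length≤ xs (as ++ bs) u xs⊆as++bs ⟩
    length (as ++ bs)      <⟨ length-++-<-∷ as ⟩
    length (as ++ z ∷ bs)  ≤⟨ |ys|≤|xs| ⟩
    length xs              ∎))
    where
    open ≤-Reasoning
    xs⊆as++bs : ∀ {v} → v ∈ xs → v ∈ as ++ bs
    xs⊆as++bs v∈xs = ∈-remove as (xs⊆ys v∈xs) (λ { refl → z∉xs v∈xs })

-- Counting with Boolean filters

indicator : Bool → ℕ
indicator true = 1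
indicator false = 0

count : (A → Bool) → List A → ℕ
count p xs = length (filterᵇ p xs)

count-∷ : ∀ (p : A → Bool) x xs → count p (x ∷ xs) ≡ indicator (p x) + count p xs
count-∷ p x xs with p x
... | true = refl
... | false = refl

count-++ : ∀ (p : A → Bool) xs ys → count p (xs ++ ys) ≡ count p xs + count p ys
count-++ p xs ys = trans (cong length (filter-++ (T? ∘ p) xs ys)) (length-++ (filterᵇ p xs))

count-none : ∀ (p : A → Bool) {xs} → All (λ x → ¬ T (p x)) xs → count p xs ≡ 0
count-none p none = cong length (filter-none (T? ∘ p) none)

count-all : ∀ (p : A → Bool) {xs} → All (T ∘ p) xs → count p xs ≡ length xs
count-all p every = cong length (filter-all (T? ∘ p) every)

count-map : ∀ (p : B → Bool) (g : A → B) xs → count p (map g xs) ≡ count (p ∘ g) xs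
count-map p g [] = refl
count-map p g (x ∷ xs) with p (g x)
... | true = cong suc (count-map p g xs)
... | false = count-map p g xs

count-concatMap : ∀ (p : B → Bool) (g : A → List B) xs →
  count p (concatMap g xs) ≡ sum (map (count p ∘ g) xs)
count-concatMap p g [] = refl
count-concatMap p g (x ∷ xs) =
  trans (count-++ p (g x) (concatMap g xs)) (cong (count p (g x) +_) (count-concatMap p g xs))

count-const-∧ : ∀ b (q : A → Bool) xs → count (λ v → b ∧ q v) xs ≡ indicator b * count q xs
count-const-∧ true q xs = sym (+-identityʳ _)
count-const-∧ false q [] = refl
count-const-∧ false q (x ∷ xs) = count-const-∧ false q xs

filterᵇ-filterᵇ : ∀ (p q : A → Bool) xs → filterᵇ q (filterᵇ p xs) ≡ filterᵇ (λ x → p x ∧ q x) xs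
filterᵇ-filterᵇ p q [] = refl
filterᵇ-filterᵇ p q (x ∷ xs) with p x
... | false = filterᵇ-filterᵇ p q xs
... | true with q x
...   | true = cong (x ∷_) (filterᵇ-filterᵇ p q xs)
...   | false = filterᵇ-filterᵇ p q xs

filterᵇ-cong-∈ : ∀ {p q : A → Bool} xs → (∀ {x} → x ∈ xs → p x ≡ q x) → filterᵇ p xs ≡ filterᵇ q xs
filterᵇ-cong-∈ [] _ = refl
filterᵇ-cong-∈ {p = p} {q} (x ∷ xs) p≗q with p x | q x | p≗q (here refl)
... | true | true | _ = cong (x ∷_) (filterᵇ-cong-∈ xs (p≗q ∘ there))
... | false | false | _ = filterᵇ-cong-∈ xs (p≗q ∘ there)

sum-map-+ : ∀ (f g : A → ℕ) xs → sum (map (λ x → f x + g x) xs) ≡ sum (map f xs) + sum (map g xs)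
sum-map-+ f g [] = refl
sum-map-+ f g (x ∷ xs) =
  trans (cong (f x + g x +_) (sum-map-+ f g xs)) (interchange (f x) (g x) (sum (map f xs)) (sum (map g xs)))

sum-map-indicator : ∀ (p : A → Bool) xs → sum (map (indicator ∘ p) xs) ≡ count p xs
sum-map-indicator p [] = refl
sum-map-indicator p (x ∷ xs) = trans (cong (indicator (p x) +_) (sum-map-indicator p xs)) (sym (count-∷ p x xs))

sum-map-indicator-* : ∀ (p : A → Bool) C xs → sum (map (λ x → indicator (p x) * C) xs) ≡ count p xs * C
sum-map-indicator-* p C [] = refl
sum-map-indicator-* p C (x ∷ xs) with p x
... | true = cong₂ _+_ (+-identityʳ C) (sum-map-indicator-* p C xs)
... | false = sum-map-indicator-* p C xs

sum-map-≡1 : ∀ (f : A → ℕ) xs → (∀ {x} → x ∈ xs → f x ≡ 1) → sum (map f xs) ≡ length xs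
sum-map-≡1 f [] _ = refl
sum-map-≡1 f (x ∷ xs) f≡1 = cong₂ _+_ (f≡1 (here refl)) (sum-map-≡1 f xs (f≡1 ∘ there))

sum-count-swap : ∀ (h : A → B → Bool) xs ys →
  sum (map (λ x → count (h x) ys) xs) ≡ sum (map (λ y → count (λ x → h x y) xs) ys)
sum-count-swap h xs [] = sum-map-zero xs
  where
  sum-map-zero : ∀ (xs : List A) → sum (map (λ _ → 0) xs) ≡ 0
  sum-map-zero [] = refl
  sum-map-zero (_ ∷ xs) = sum-map-zero xs
sum-count-swap h xs (y ∷ ys) = begin
  sum (map (λ x → count (h x) (y ∷ ys)) xs)
    ≡⟨ cong sum (map-cong (λ x → count-∷ (h x) y ys) xs) ⟩
  sum (map (λ x → indicator (h x y) + count (h x) ys) xs)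
    ≡⟨ sum-map-+ (λ x → indicator (h x y)) (λ x → count (h x) ys) xs ⟩
  sum (map (λ x → indicator (h x y)) xs) + sum (map (λ x → count (h x) ys) xs)
    ≡⟨ cong₂ _+_ (sum-map-indicator (λ x → h x y) xs) (sum-count-swap h xs ys) ⟩
  count (λ x → h x y) xs + sum (map (λ y → count (λ x → h x y) xs) ys) ∎
  where open ≡-Reasoning

-- Blocks of consecutive spots

∈-block⁻ : ∀ {k a l} → k ∈ block a l → a ≤ k × k < a + l
∈-block⁻ {a = a} {suc l} (here refl) = ≤-refl , m<m+n a z<s
∈-block⁻ {k} {a} {suc l} (there k∈) with a<k , k<a+1+l ← ∈-block⁻ k∈ =
  <⇒≤ a<k , subst (k <_) (sym (+-suc a l)) k<a+1+l

∈-block⁺ : ∀ {k a l} → a ≤ k → k < a + l → k ∈ block a l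
∈-block⁺ {k} {a} {zero} a≤k k<a+0 = ⊥-elim (<⇒≱ k<a+0 (subst (_≤ k) (sym (+-identityʳ a)) a≤k))
∈-block⁺ {k} {a} {suc l} a≤k k<a+l with m≤n⇒m<n∨m≡n a≤k
... | inj₂ refl = here refl
... | inj₁ a<k = there (∈-block⁺ a<k (subst (k <_) (+-suc a l) k<a+l))

length-block : ∀ a l → length (block a l) ≡ l
length-block a zero = refl
length-block a (suc l) = cong suc (length-block (suc a) l)

block-++ : ∀ a l l′ → block a (l + l′) ≡ block a l ++ block (a + l) l′
block-++ a zero l′ = cong (λ b → block b l′) (sym (+-identityʳ a))
block-++ a (suc l) l′ =
  cong (a ∷_) (trans (block-++ (suc a) l l′) (cong (λ b → block (suc a) l ++ block b l′) (sym (+-suc a l))))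

block-unique : ∀ a l → Unique (block a l)
block-unique a zero = []
block-unique a (suc l) =
  All.tabulate (λ { k∈ refl → <-irrefl refl (proj₁ (∈-block⁻ k∈)) }) ∷ block-unique (suc a) l

applyUpTo-block : ∀ (f : ℕ → ℕ) a l → (∀ i → f i ≡ a + i) → applyUpTo f l ≡ block a l
applyUpTo-block f a zero _ = refl
applyUpTo-block f a (suc l) f≗a+ =
  cong₂ _∷_ (trans (f≗a+ 0) (+-identityʳ a))
            (applyUpTo-block (f ∘ suc) (suc a) l (λ i → trans (f≗a+ (suc i)) (+-suc a i)))

spots≡block : ∀ m → spots m ≡ block 1 m
spots≡block m = trans (map-upTo suc m) (applyUpTo-block suc 1 m (λ _ → refl))

IsFirstFrom : (ℕ → Bool) → ℕ → ℕ → Set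
IsFirstFrom f a j = a ≤ j × T (f j) × (∀ {i} → a ≤ i → i < j → ¬ T (f i))

head-filterᵇ-block⁻ : ∀ f a l {j} → head (filterᵇ f (block a l)) ≡ just j → j < a + l × IsFirstFrom f a j
head-filterᵇ-block⁻ f a (suc l) {j} eq with f a in fa
head-filterᵇ-block⁻ f a (suc l) refl | true =
  m<m+n a z<s , ≤-refl , from T-≡ fa , λ a≤i i<a → ⊥-elim (<⇒≱ i<a a≤i)
... | false with head-filterᵇ-block⁻ f (suc a) l eq
... | j<end , a<j , fj , earlier =
  subst (j <_) (sym (+-suc a l)) j<end , <⇒≤ a<j , fj , earlier′
  where
  earlier′ : ∀ {i} → a ≤ i → i < j → ¬ T (f i)
  earlier′ a≤i i<j with m≤n⇒m<n∨m≡n a≤i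
  ... | inj₂ refl = λ fi → subst T fa fi
  ... | inj₁ a<i = earlier a<i i<j

head-filterᵇ-block⁺ : ∀ f a l {j} → j < a + l → IsFirstFrom f a j → head (filterᵇ f (block a l)) ≡ just j
head-filterᵇ-block⁺ f a zero {j} j<a+0 (a≤j , _) = ⊥-elim (<⇒≱ j<a+0 (subst (_≤ j) (sym (+-identityʳ a)) a≤j))
head-filterᵇ-block⁺ f a (suc l) {j} j<end (a≤j , fj , earlier) with m≤n⇒m<n∨m≡n a≤j | f a in fa
... | inj₂ refl | true = refl
... | inj₂ refl | false = ⊥-elim (subst T fa fj)
... | inj₁ a<j | true = ⊥-elim (earlier ≤-refl a<j (from T-≡ fa))
... | inj₁ a<j | false =
  head-filterᵇ-block⁺ f (suc a) l (subst (j <_) (+-suc a l) j<end) (a<j , fj , earlier ∘ <⇒≤)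

count-interval : ∀ a w m → a + w ≤ m → count (λ v → (suc a ≤ᵇ v) ∧ (v ≤ᵇ a + w)) (block 1 m) ≡ w
count-interval a w m a+w≤m with b , refl ← m≤n⇒∃[o]m+o≡n a+w≤m = begin
  count p (block 1 (a + w + b))
    ≡⟨ cong (count p) (trans (cong (block 1) (+-assoc a w b))
                             (trans (block-++ 1 a (w + b)) (cong (block 1 a ++_) (block-++ (suc a) w b)))) ⟩
  count p (block 1 a ++ block (suc a) w ++ block (suc a + w) b)
    ≡⟨ count-++ p (block 1 a) _ ⟩
  count p (block 1 a) + count p (block (suc a) w ++ block (suc a + w) b)
    ≡⟨ cong (count p (block 1 a) +_) (count-++ p (block (suc a) w) _) ⟩
  count p (block 1 a) + (count p (block (suc a) w) + count p (block (suc a + w) b))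
    ≡⟨ cong₂ (λ u v → u + (v + count p (block (suc a + w) b))) (count-none p below) (count-all p inside) ⟩
  length (block (suc a) w) + count p (block (suc a + w) b)
    ≡⟨ cong₂ _+_ (length-block (suc a) w) (count-none p above) ⟩
  w + 0
    ≡⟨ +-identityʳ w ⟩
  w ∎
  where
  open ≡-Reasoning
  p = λ v → (suc a ≤ᵇ v) ∧ (v ≤ᵇ a + w)
  below : All (λ v → ¬ T (p v)) (block 1 a)
  below = All.tabulate λ v∈ pv → <⇒≱ (proj₂ (∈-block⁻ v∈)) (≤ᵇ⇒≤ _ _ (proj₁ (to T-∧ pv)))
  inside : All (T ∘ p) (block (suc a) w)
  inside = All.tabulate λ v∈ → let a<v , v<end = ∈-block⁻ v∈ in
    from T-∧ (≤⇒≤ᵇ a<v , ≤⇒≤ᵇ (≤-pred v<end))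
  above : All (λ v → ¬ T (p v)) (block (suc a + w) b)
  above = All.tabulate λ v∈ pv → <⇒≱ (proj₁ (∈-block⁻ v∈)) (≤ᵇ⇒≤ _ _ (proj₂ (to T-∧ pv)))

-- Vectors with entries from a list

pointwise : ∀ {k} → (Fin k → A → Bool) → Vec A k → Bool
pointwise p V.[] = true
pointwise p (a V.∷ v) = p F.zero a ∧ pointwise (p ∘ F.suc) v

T-pointwise⁻ : ∀ {k} (p : Fin k → A → Bool) v → T (pointwise p v) → ∀ i → T (p i (lookup v i))
T-pointwise⁻ p (a V.∷ v) t F.zero = proj₁ (to T-∧ t)
T-pointwise⁻ p (a V.∷ v) t (F.suc i) = T-pointwise⁻ (p ∘ F.suc) v (proj₂ (to T-∧ t)) i

T-pointwise⁺ : ∀ {k} (p : Fin k → A → Bool) v → (∀ i → T (p i (lookup v i))) → T (pointwise p v)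
T-pointwise⁺ p V.[] _ = tt
T-pointwise⁺ p (a V.∷ v) pv = from T-∧ (pv F.zero , T-pointwise⁺ (p ∘ F.suc) v (pv ∘ F.suc))

count-pointwise-vecsOver : ∀ (xs : List A) k (p : Fin k → A → Bool) →
  count (pointwise p) (vecsOver xs k) ≡ product (tabulate (λ i → count (p i) xs))
count-pointwise-vecsOver xs zero p = refl
count-pointwise-vecsOver xs (suc k) p = begin
  count (pointwise p) (concatMap (λ a → map (a V.∷_) (vecsOver xs k)) xs)
    ≡⟨ count-concatMap (pointwise p) _ xs ⟩
  sum (map (λ a → count (pointwise p) (map (a V.∷_) (vecsOver xs k))) xs)
    ≡⟨ cong sum (map-cong by-head xs) ⟩
  sum (map (λ a → indicator (p F.zero a) * rest) xs)
    ≡⟨ sum-map-indicator-* (p F.zero) rest xs ⟩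
  count (p F.zero) xs * rest
    ≡⟨ cong (count (p F.zero) xs *_) (count-pointwise-vecsOver xs k (p ∘ F.suc)) ⟩
  product (tabulate (λ i → count (p i) xs)) ∎
  where
  open ≡-Reasoning
  rest = count (pointwise (p ∘ F.suc)) (vecsOver xs k)
  by-head : ∀ a → count (pointwise p) (map (a V.∷_) (vecsOver xs k)) ≡ indicator (p F.zero a) * rest
  by-head a = trans (count-map (pointwise p) (a V.∷_) (vecsOver xs k))
                    (count-const-∧ (p F.zero a) (pointwise (p ∘ F.suc)) (vecsOver xs k))

∈-vecsOver⁻ : ∀ (xs : List A) k {v} → v ∈ vecsOver xs k → ∀ i → lookup v i ∈ xs
∈-vecsOver⁻ xs (suc k) v∈ i
  with _ , v∈as , as∈ ← ∈-concat⁻′ (map (λ a → map (a V.∷_) (vecsOver xs k)) xs) v∈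
  with a , a∈xs , refl ← ∈-map⁻ (λ a → map (a V.∷_) (vecsOver xs k)) as∈
  with v′ , v′∈ , refl ← ∈-map⁻ (a V.∷_) v∈as
  with i
... | F.zero = a∈xs
... | F.suc i′ = ∈-vecsOver⁻ xs k v′∈ i′

count-≡ᶠ-unique : ∀ {n} {c : Fin n} {xs} → Unique xs → c ∈ xs → count (c ≡ᶠ_) xs ≡ 1
count-≡ᶠ-unique {c = c} {_ ∷ xs} (c∉xs ∷ _) (here refl) =
  trans (count-∷ (c ≡ᶠ_) c xs)
        (cong₂ _+_ (cong indicator (to T-≡ (≡ᶠ-refl c)))
                   (count-none (c ≡ᶠ_) (All.map (λ {d} c≢d t → c≢d (≡ᶠ⇒≡ c d t)) c∉xs)))
count-≡ᶠ-unique {c = c} {b ∷ xs} (b∉xs ∷ u) (there c∈xs) =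
  trans (count-∷ (c ≡ᶠ_) b xs)
        (cong₂ _+_ (cong indicator (≢⇒≡ᶠ-false {c = c} {b} (λ { refl → All.lookup b∉xs c∈xs refl })))
                   (count-≡ᶠ-unique u c∈xs))

count-eqWord-vecsOver : ∀ {n} k (w : List (Fin n)) → length w ≡ k →
  count (λ v → eqWord w (V.toList v)) (vecsOver (allFin n) k) ≡ 1
count-eqWord-vecsOver zero [] _ = refl
count-eqWord-vecsOver {n} (suc k) (c ∷ w) |w|≡1+k = begin
  count matches (concatMap (λ a → map (a V.∷_) (vecsOver (allFin n) k)) (allFin n))
    ≡⟨ count-concatMap matches _ (allFin n) ⟩
  sum (map (λ a → count matches (map (a V.∷_) (vecsOver (allFin n) k))) (allFin n))
    ≡⟨ cong sum (map-cong by-head (allFin n)) ⟩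
  sum (map (λ a → indicator (c ≡ᶠ a) * 1) (allFin n))
    ≡⟨ sum-map-indicator-* (c ≡ᶠ_) 1 (allFin n) ⟩
  count (c ≡ᶠ_) (allFin n) * 1
    ≡⟨ *-identityʳ _ ⟩
  count (c ≡ᶠ_) (allFin n)
    ≡⟨ count-≡ᶠ-unique (Unique.allFin⁺ n) (∈-allFin c) ⟩
  1 ∎
  where
  open ≡-Reasoning
  matches = λ v → eqWord (c ∷ w) (V.toList v)
  by-head : ∀ a → count matches (map (a V.∷_) (vecsOver (allFin n) k)) ≡ indicator (c ≡ᶠ a) * 1
  by-head a = begin
    count matches (map (a V.∷_) (vecsOver (allFin n) k))
      ≡⟨ count-map matches (a V.∷_) (vecsOver (allFin n) k) ⟩
    count (λ v → (c ≡ᶠ a) ∧ eqWord w (V.toList v)) (vecsOver (allFin n) k)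
      ≡⟨ count-const-∧ (c ≡ᶠ a) (λ v → eqWord w (V.toList v)) (vecsOver (allFin n) k) ⟩
    indicator (c ≡ᶠ a) * count (λ v → eqWord w (V.toList v)) (vecsOver (allFin n) k)
      ≡⟨ cong (indicator (c ≡ᶠ a) *_) (count-eqWord-vecsOver k w (suc-injective |w|≡1+k)) ⟩
    indicator (c ≡ᶠ a) * 1 ∎

length-allFin : ∀ n → length (allFin n) ≡ n
length-allFin n = length-tabulate {n = n} (λ i → i)

unique-length⇒complete : ∀ {n} (xs : List (Fin n)) → Unique xs → length xs ≡ n → ∀ c → c ∈ xs
unique-length⇒complete {n} xs u |xs|≡n c =
  unique-⊆-length≥⇒⊇ F._≟_ xs (allFin n) u (λ {z} _ → ∈-allFin z)
    (≤-reflexive (trans (length-allFin n) (sym |xs|≡n))) (∈-allFin c)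

complete-unique⇒length : ∀ {n} (xs : List (Fin n)) → Unique xs → (∀ c → c ∈ xs) → length xs ≡ n
complete-unique⇒length {n} xs u complete = ≤-antisym
  (subst (length xs ≤_) (length-allFin n) (unique-⊆⇒length≤ xs (allFin n) u (λ {z} _ → ∈-allFin z)))
  (subst (_≤ length xs) (length-allFin n) (unique-⊆⇒length≤ (allFin n) xs (Unique.allFin⁺ n) (λ {z} _ → complete z)))

mapMaybe-∷-just : ∀ (f : A → Maybe B) {x c} xs → f x ≡ just c → mapMaybe f (x ∷ xs) ≡ c ∷ mapMaybe f xs
mapMaybe-∷-just f xs fx≡c rewrite fx≡c = refl

mapMaybe-none : ∀ (f : A → Maybe B) {xs} → All (λ x → f x ≡ nothing) xs → mapMaybe f xs ≡ []
mapMaybe-none f [] = refl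
mapMaybe-none f {x ∷ _} (fx≡nothing ∷ none) rewrite fx≡nothing = mapMaybe-none f none

sum-map-lookup-allFin : ∀ {k} (v : Vec ℕ k) → sum (map (lookup v) (allFin k)) ≡ V.sum v
sum-map-lookup-allFin V.[] = refl
sum-map-lookup-allFin {suc k} (a V.∷ v) = cong (a +_) (begin
  sum (map (lookup (a V.∷ v)) (tabulate F.suc)) ≡⟨ cong sum (map-tabulate F.suc (lookup (a V.∷ v))) ⟩
  sum (tabulate (lookup v))                     ≡⟨ cong sum (map-tabulate (λ i → i) (lookup v)) ⟨
  sum (map (lookup v) (allFin k))               ≡⟨ sum-map-lookup-allFin v ⟩
  V.sum v                                       ∎)
  where open ≡-Reasoning

unique-∷-∉ˡ : ∀ (u : List A) {d v} → Unique (u ++ d ∷ v) → d ∉ u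
unique-∷-∉ˡ (c ∷ u) (c∉ ∷ _) (here refl) = All.lookup c∉ (∈-++⁺ʳ u (here refl)) refl
unique-∷-∉ˡ (c ∷ u) (_ ∷ uniq) (there d∈u) = unique-∷-∉ˡ u uniq d∈u

take-length-++ : ∀ (u : List A) v → take (length u) (u ++ v) ≡ u
take-length-++ [] v = refl
take-length-++ (a ∷ u) v = cong (a ∷_) (take-length-++ u v)

takeWhileᵇ-split : ∀ (p : A → Bool) xs → ∃[ rest ] (xs ≡ takeWhileᵇ p xs ++ rest × All (T ∘ p) (takeWhileᵇ p xs) ×
  (rest ≡ [] ⊎ ∃[ e ] ∃[ rest′ ] (rest ≡ e ∷ rest′ × ¬ T (p e))))
takeWhileᵇ-split p [] = [] , refl , [] , inj₁ refl
takeWhileᵇ-split p (x ∷ xs) with p x in px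
... | false = x ∷ xs , refl , [] , inj₂ (x , xs , refl , λ t → subst T px t)
... | true with rest , xs≡ , taken , stop ← takeWhileᵇ-split p xs = rest , cong (x ∷_) xs≡ , from T-≡ px ∷ taken , stop

position : ∀ {n} → List (Fin n) → Fin n → ℕ
position [] d = 0
position (c ∷ w) d = if c ≡ᶠ d then 0 else suc (position w d)

position-split : ∀ {n} (u : List (Fin n)) d v → d ∉ u → position (u ++ d ∷ v) d ≡ length u
position-split [] d v _ rewrite to T-≡ (≡ᶠ-refl d) = refl
position-split (c ∷ u) d v d∉ rewrite ≢⇒≡ᶠ-false {c = c} {d} (λ { refl → d∉ (here refl) }) =
  cong suc (position-split u d v (d∉ ∘ there))

Increasing : ∀ {n} → List (Fin n) → Set
Increasing = AllPairs F._<_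

allFin-increasing : ∀ n → Increasing (allFin n)
allFin-increasing n = tabulate⁺-< (λ i<j → i<j)

smaller⇒done : ∀ {n} {D cs : List (Fin n)} {c} → (∀ d → d ∈ D ⊎ d ∈ c ∷ cs) → All (c F.<_) cs →
  ∀ {d} → d F.< c → d ∈ D
smaller⇒done every c<cs {d} d<c with every d
... | inj₁ d∈D = d∈D
... | inj₂ (here refl) = ⊥-elim (<-irrefl refl d<c)
... | inj₂ (there d∈cs) = ⊥-elim (<-asym d<c (All.lookup c<cs d∈cs))

module Parking (n : ℕ) (y : Vec ℕ n) (length-positive : ∀ c → 1 ≤ lookup y c) where

  len : Fin n → ℕ
  len = lookup y

  m : ℕ
  m = totalLength y

  Entry : Set
  Entry = ℕ × Fin n

  spotsOf : Entry → List ℕ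
  spotsOf (b , c) = block b (len c)

  occupied : List Entry → List ℕ
  occupied = concatMap spotsOf

  streetOf : List Entry → Street n
  streetOf P = street (occupied P) P

  start∈block : ∀ b c → b ∈ block b (len c)
  start∈block b c = ∈-block⁺ ≤-refl (m<m+n b (length-positive c))

  isOccupied⇒∈ : ∀ P {k} → T (isOccupied (streetOf P) k) → k ∈ occupied P
  isOccupied⇒∈ P = T-any-≡ᵇ⇒∈ (occupied P)

  ∈-occupied⁻ : ∀ P {k} → k ∈ occupied P → ∃[ e ] (e ∈ P × k ∈ spotsOf e)
  ∈-occupied⁻ P k∈
    with _ , k∈bs , bs∈ ← ∈-concat⁻′ (map spotsOf P) k∈
    with e , e∈P , refl ← ∈-map⁻ spotsOf bs∈ = e , e∈P , k∈bs

  ∈-occupied⁺ : ∀ {P e k} → e ∈ P → k ∈ spotsOf e → k ∈ occupied P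
  ∈-occupied⁺ e∈P k∈e = ∈-concat⁺′ k∈e (∈-map⁺ spotsOf e∈P)

  length-occupied : ∀ P → length (occupied P) ≡ sum (map len (map proj₂ P))
  length-occupied [] = refl
  length-occupied ((b , c) ∷ P) =
    trans (length-++ (block b (len c))) (cong₂ _+_ (length-block b (len c)) (length-occupied P))

  record ParksAt (x : Vec ℕ n) (c : Fin n) (b : ℕ) (P : List Entry) : Set where
    field
      1≤start : 1 ≤ b
      end≤1+m : b + len c ≤ suc m
      fresh : ∀ {k} → k ∈ block b (len c) → k ∉ occupied P
      after-smaller : All (λ e → proj₂ e F.< c) P
      pref≤start : lookup x c ≤ b
      passed-occupied : ∀ {k} → lookup x c ≤ k → 1 ≤ k → k < b → k ∈ occupied P

  -- Like the street built by parkCar, a trace lists the parked cars newest first.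
  data Trace (x : Vec ℕ n) : List Entry → Set where
    [] : Trace x []
    _∷_ : ∀ {b c P} → ParksAt x c b P → Trace x P → Trace x ((b , c) ∷ P)

  parkCar-just⁻ : ∀ (c : Fin n) l p s {s′} → parkCar m c l p s ≡ just s′ →
    ∃[ j ] (firstEmpty m s p ≡ just j × T (blockFree m s (block j l)) ×
            s′ ≡ street (block j l ++ occupiedSpots s) ((j , c) ∷ parked s))
  parkCar-just⁻ c l p s eq with firstEmpty m s p
  ... | just j with blockFree m s (block j l) in free
  parkCar-just⁻ c l p s refl | just j | true = j , refl , from T-≡ free , refl

  parkCar-just⁺ : ∀ (c : Fin n) l p s {j} → firstEmpty m s p ≡ just j → T (blockFree m s (block j l)) →
    parkCar m c l p s ≡ just (street (block j l ++ occupiedSpots s) ((j , c) ∷ parked s))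
  parkCar-just⁺ c l p s first free with firstEmpty m s p
  parkCar-just⁺ c l p s {j} refl free | just .j with blockFree m s (block j l)
  ... | true = refl

  freeFrom : ℕ → Street n → ℕ → Bool
  freeFrom p s j = (p ≤ᵇ j) ∧ not (isOccupied s j)

  firstEmpty-just⁻ : ∀ s p {j} → firstEmpty m s p ≡ just j → j < 1 + m × IsFirstFrom (freeFrom p s) 1 j
  firstEmpty-just⁻ s p {j} eq =
    head-filterᵇ-block⁻ (freeFrom p s) 1 m (subst (λ xs → head (filterᵇ (freeFrom p s) xs) ≡ just j) (spots≡block m) eq)

  firstEmpty-just⁺ : ∀ s p {j} → j < 1 + m → IsFirstFrom (freeFrom p s) 1 j → firstEmpty m s p ≡ just j
  firstEmpty-just⁺ s p {j} j≤m first =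
    subst (λ xs → head (filterᵇ (freeFrom p s) xs) ≡ just j) (sym (spots≡block m)) (head-filterᵇ-block⁺ _ 1 m j≤m first)

  block≤m⇒end≤1+m : ∀ j l → j ≤ suc m → (∀ {k} → k ∈ block j l → k ≤ m) → j + l ≤ suc m
  block≤m⇒end≤1+m j zero j≤ _ = subst (_≤ suc m) (sym (+-identityʳ j)) j≤
  block≤m⇒end≤1+m j (suc l) _ within = subst (_≤ suc m) (sym (+-suc j l))
    (block≤m⇒end≤1+m (suc j) l (s≤s (within (here refl))) (within ∘ there))

  parksAt : ∀ x c P {j} → All (λ e → proj₂ e F.< c) P →
    firstEmpty m (streetOf P) (lookup x c) ≡ just j → T (blockFree m (streetOf P) (block j (len c))) →
    ParksAt x c j P
  parksAt x c P {j} smaller first free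
    with j<1+m , 1≤j , j-free , before ← firstEmpty-just⁻ (streetOf P) (lookup x c) first = record
    { 1≤start = 1≤j
    ; end≤1+m = block≤m⇒end≤1+m j (len c) (<⇒≤ j<1+m) (λ k∈ → ≤ᵇ⇒≤ _ m (proj₁ (to T-∧ (spot-free k∈))))
    ; fresh = λ k∈ k∈occ → T-not⇒¬T (proj₂ (to T-∧ (spot-free k∈))) (∈⇒T-any-≡ᵇ k∈occ)
    ; after-smaller = smaller
    ; pref≤start = ≤ᵇ⇒≤ (lookup x c) j (proj₁ (to T-∧ j-free))
    ; passed-occupied = λ {k} x≤k 1≤k k<j → isOccupied⇒∈ P (occupied-or-free k (before 1≤k k<j) x≤k)
    }
    where
    spot-free : ∀ {k} → k ∈ block j (len c) → T ((k ≤ᵇ m) ∧ not (isOccupied (streetOf P) k))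
    spot-free = All.lookup (all⁺ _ (block j (len c)) free)
    occupied-or-free : ∀ k → ¬ T (freeFrom (lookup x c) (streetOf P) k) → lookup x c ≤ k →
      T (isOccupied (streetOf P) k)
    occupied-or-free k not-free x≤k with isOccupied (streetOf P) k in occ
    ... | true = tt
    ... | false = not-free (from T-∧ (≤⇒≤ᵇ x≤k , tt))

  run-trace : ∀ x cs P {s} → Trace x P → Increasing cs → All (λ e → All (λ d → proj₂ e F.< d) cs) P →
    runCars m y x cs (streetOf P) ≡ just s →
    ∃[ P′ ] (s ≡ streetOf P′ × Trace x P′ × map proj₂ P′ ≡ cs ʳ++ map proj₂ P)
  run-trace x [] P tr _ _ refl = P , refl , tr , refl
  run-trace x (c ∷ cs) P tr (c<cs ∷ inc) P<cs eq
    with parkCar m c (len c) (lookup x c) (streetOf P) in parked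
  run-trace x (c ∷ cs) P tr (c<cs ∷ inc) P<cs () | nothing
  ... | just s′ with parkCar-just⁻ c (len c) (lookup x c) (streetOf P) parked
  ... | j , first , free , refl =
    run-trace x cs ((j , c) ∷ P) (parksAt x c P (All.map All.head P<cs) first free ∷ tr) inc
      (c<cs ∷ All.map All.tail P<cs) eq

  process-trace : ∀ x {s} → parkingProcess y x ≡ just s →
    ∃[ P ] (s ≡ streetOf P × Trace x P × map proj₂ P ≡ reverse (allFin n))
  process-trace x = run-trace x (allFin n) [] [] (allFin-increasing n) []

  trace-entry : ∀ {x P b c} → Trace x P → (b , c) ∈ P → ∃[ Q ] (ParksAt x c b Q × (∀ {e} → e ∈ Q → e ∈ P))
  trace-entry (st ∷ _) (here refl) = _ , st , there
  trace-entry (_ ∷ tr) (there e∈P) with Q , st , Q⊆ ← trace-entry tr e∈P = Q , st , there ∘ Q⊆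

  trace-disjoint : ∀ {x P e e′ k} → Trace x P → e ∈ P → e′ ∈ P → k ∈ spotsOf e → k ∈ spotsOf e′ → e ≡ e′
  trace-disjoint (_ ∷ _) (here refl) (here refl) _ _ = refl
  trace-disjoint (st ∷ _) (here refl) (there e′∈P) k∈e k∈e′ = ⊥-elim (ParksAt.fresh st k∈e (∈-occupied⁺ e′∈P k∈e′))
  trace-disjoint (st ∷ _) (there e∈P) (here refl) k∈e k∈e′ = ⊥-elim (ParksAt.fresh st k∈e′ (∈-occupied⁺ e∈P k∈e))
  trace-disjoint (_ ∷ tr) (there e∈P) (there e′∈P) = trace-disjoint tr e∈P e′∈P

  trace-start-unique : ∀ {x P b b′ c} → Trace x P → (b , c) ∈ P → (b′ , c) ∈ P → b ≡ b′
  trace-start-unique (_ ∷ _) (here refl) (here refl) = refl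
  trace-start-unique (st ∷ _) (here refl) (there e∈P) = ⊥-elim (<-irrefl refl (All.lookup (ParksAt.after-smaller st) e∈P))
  trace-start-unique (st ∷ _) (there e∈P) (here refl) = ⊥-elim (<-irrefl refl (All.lookup (ParksAt.after-smaller st) e∈P))
  trace-start-unique (_ ∷ tr) (there e∈P) (there e′∈P) = trace-start-unique tr e∈P e′∈P

  trace-occupied-unique : ∀ {x P} → Trace x P → Unique (occupied P)
  trace-occupied-unique [] = []
  trace-occupied-unique {P = (b , c) ∷ _} (st ∷ tr) =
    Unique.++⁺ (block-unique b (len c)) (trace-occupied-unique tr) (λ { (k∈ , k∈′) → ParksAt.fresh st k∈ k∈′ })

  trace-occupied-range : ∀ {x P k} → Trace x P → k ∈ occupied P → 1 ≤ k × k ≤ m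
  trace-occupied-range {P = P} tr k∈
    with (b , c) , e∈P , k∈e ← ∈-occupied⁻ P k∈
    with _ , st , _ ← trace-entry tr e∈P
    with b≤k , k<end ← ∈-block⁻ k∈e =
    ≤-trans (ParksAt.1≤start st) b≤k , ≤-pred (≤-trans k<end (ParksAt.end≤1+m st))

  Layout : List Entry → ℕ → List (Fin n) → Set
  Layout P p [] = p ≡ suc m
  Layout P p (c ∷ w) = (p , c) ∈ P × Layout P (p + len c) w

  carAt-just⁻ : ∀ (P : List Entry) {k c} → carAt P k ≡ just c → (k , c) ∈ P
  carAt-just⁻ ((b , d) ∷ P) {k} eq with k ≡ᵇ b in k≡b
  carAt-just⁻ ((b , d) ∷ P) {k} refl | true with refl ← ≡ᵇ⇒≡ k b (from T-≡ k≡b) = here refl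
  ... | false = there (carAt-just⁻ P eq)

  module _ {x P} (tr : Trace x P) where

    carAt-start : ∀ {b c} → (b , c) ∈ P → carAt P b ≡ just c
    carAt-start {b} {c} = go P (λ e∈ e′∈ → trace-disjoint tr e∈ e′∈)
      where
      go : ∀ Q → (∀ {e e′ k} → e ∈ Q → e′ ∈ Q → k ∈ spotsOf e → k ∈ spotsOf e′ → e ≡ e′) →
        (b , c) ∈ Q → carAt Q b ≡ just c
      go ((b′ , d) ∷ Q) disjoint e∈Q with b ≡ᵇ b′ in b≡b′
      ... | true with refl ← ≡ᵇ⇒≡ b b′ (from T-≡ b≡b′) =
        cong (just ∘ proj₂) (disjoint (here refl) e∈Q (start∈block b d) (start∈block b c))
      ... | false with e∈Q
      ...   | here refl = ⊥-elim (subst T b≡b′ (≡⇒≡ᵇ b b refl))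
      ...   | there e∈Q′ = go Q (λ e∈ e′∈ → disjoint (there e∈) (there e′∈)) e∈Q′

    trace-overlap : ∀ {b c b′ c′} → (b , c) ∈ P → (b′ , c′) ∈ P → b < b′ + len c′ → b′ < b + len c →
      (b , c) ≡ (b′ , c′)
    trace-overlap {b} {c} {b′} {c′} e∈P e′∈P b<end′ b′<end with ≤-total b b′
    ... | inj₁ b≤b′ = trace-disjoint tr e∈P e′∈P (∈-block⁺ b≤b′ b′<end) (start∈block b′ c′)
    ... | inj₂ b′≤b = trace-disjoint tr e∈P e′∈P (start∈block b c) (∈-block⁺ b′≤b b<end′)

    layout-start : ∀ p w {d} → Layout P p w → d ∈ w → ∃[ b ] (p ≤ b × (b , d) ∈ P)
    layout-start p (c ∷ w) (c∈ , _) (here refl) = p , ≤-refl , c∈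
    layout-start p (c ∷ w) (_ , lay) (there d∈w) with b , p+len≤b , d∈ ← layout-start (p + len c) w lay d∈w =
      b , ≤-trans (m≤m+n p (len c)) p+len≤b , d∈

    layout-unique : ∀ p w → Layout P p w → Unique w
    layout-unique p [] _ = []
    layout-unique p (c ∷ w) (c∈ , lay) = All.tabulate c-not-later ∷ layout-unique (p + len c) w lay
      where
      c-not-later : ∀ {d} → d ∈ w → c ≢ d
      c-not-later d∈w refl with b , p+len≤b , c∈′ ← layout-start (p + len c) w lay d∈w
        with refl ← trace-start-unique tr c∈ c∈′ = <-irrefl refl (<-≤-trans (m<m+n p (length-positive c)) p+len≤b)

    layout-complete : ∀ p w {b c} → Layout P p w → (b , c) ∈ P → p ≤ b → c ∈ w
    layout-complete p [] {b} {c} refl e∈P p≤b with _ , st , _ ← trace-entry tr e∈P =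
      ⊥-elim (<-irrefl refl (begin-strict
        suc m        ≤⟨ p≤b ⟩
        b            <⟨ m<m+n b (length-positive c) ⟩
        b + len c    ≤⟨ ParksAt.end≤1+m st ⟩
        suc m        ∎))
      where open ≤-Reasoning
    layout-complete p (c′ ∷ w) {b} {c} (c′∈ , lay) e∈P p≤b with m≤n⇒m<n∨m≡n p≤b
    ... | inj₂ refl with refl ← trace-disjoint tr c′∈ e∈P (start∈block p c′) (start∈block p c) = here refl
    ... | inj₁ p<b with p + len c′ ≤? b
    ...   | yes p+len≤b = there (layout-complete (p + len c′) w lay e∈P p+len≤b)
    ...   | no p+len≰b with refl ← trace-disjoint tr c′∈ e∈P (∈-block⁺ (<⇒≤ p<b) (≰⇒> p+len≰b)) (start∈block b c) =
      ⊥-elim (<-irrefl refl p<b)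

    layout-deterministic : ∀ p w w′ → Layout P p w → Layout P p w′ → w ≡ w′
    layout-deterministic p [] [] _ _ = refl
    layout-deterministic p [] (c ∷ w′) refl (c∈ , _) with () ← layout-complete (suc m) [] refl c∈ ≤-refl
    layout-deterministic p (c ∷ w) [] (c∈ , _) refl with () ← layout-complete (suc m) [] refl c∈ ≤-refl
    layout-deterministic p (c ∷ w) (c′ ∷ w′) (c∈ , lay) (c′∈ , lay′)
      with refl ← trace-disjoint tr c∈ c′∈ (start∈block p c) (start∈block p c′) =
      cong (c ∷_) (layout-deterministic (p + len c) w w′ lay lay′)

    layout-position : ∀ p w {d} → Layout P p w → d ∈ w → ∃[ u ] ∃[ v ] (w ≡ u ++ d ∷ v × (p + sum (map len u) , d) ∈ P)
    layout-position p (c ∷ w) (c∈ , _) (here refl) = [] , w , refl , subst (λ b → (b , c) ∈ P) (sym (+-identityʳ p)) c∈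
    layout-position p (c ∷ w) {d} (_ , lay) (there d∈w) with u , v , refl , d∈ ← layout-position (p + len c) w lay d∈w =
      c ∷ u , v , refl , subst (λ b → (b , d) ∈ P) (+-assoc p (len c) (sum (map len u))) d∈

  module Complete {x P} (tr : Trace x P) (all-parked : map proj₂ P ≡ reverse (allFin n)) where

    length-occupied≡m : length (occupied P) ≡ m
    length-occupied≡m = begin
      length (occupied P)                 ≡⟨ length-occupied P ⟩
      sum (map len (map proj₂ P))         ≡⟨ cong (sum ∘ map len) all-parked ⟩
      sum (map len (reverse (allFin n)))  ≡⟨ sum-↭ (Perm.map⁺ len (↭-reverse (allFin n))) ⟩
      sum (map len (allFin n))            ≡⟨ sum-map-lookup-allFin y ⟩
      m                                   ∎
      where open ≡-Reasoning

    occupied-cover : ∀ {k} → 1 ≤ k → k ≤ m → k ∈ occupied P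
    occupied-cover 1≤k k≤m =
      unique-⊆-length≥⇒⊇ _≟_ (occupied P) (block 1 m) (trace-occupied-unique tr)
        (λ k∈ → let 1≤ , ≤m = trace-occupied-range tr k∈ in ∈-block⁺ 1≤ (s≤s ≤m))
        (≤-reflexive (trans (length-block 1 m) (sym length-occupied≡m)))
        (∈-block⁺ 1≤k (s≤s k≤m))

    StartOrEnd : ℕ → Set
    StartOrEnd p = p ≡ suc m ⊎ ∃[ c ] ((p , c) ∈ P)

    next-start : ∀ {p c} → (p , c) ∈ P → StartOrEnd (p + len c)
    next-start {p} {c} e∈P with _ , st , _ ← trace-entry tr e∈P | m≤n⇒m<n∨m≡n (ParksAt.end≤1+m st)
    ... | inj₂ end≡1+m = inj₁ end≡1+m
    ... | inj₁ end≤m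
      with (b′ , d) , e′∈P , end∈ ← ∈-occupied⁻ P (occupied-cover (≤-trans (ParksAt.1≤start st) (m≤m+n p (len c))) (≤-pred end≤m))
      with b′≤end , end<b′+ ← ∈-block⁻ end∈
      with m≤n⇒m<n∨m≡n b′≤end
    ... | inj₂ refl = inj₂ (d , e′∈P)
    ... | inj₁ b′<end with refl ← trace-overlap tr e′∈P e∈P b′<end (≤-<-trans (m≤m+n p (len c)) end<b′+) =
      ⊥-elim (<-irrefl refl (proj₂ (∈-block⁻ end∈)))

    read-car : ∀ {p c} r → (p , c) ∈ P →
      mapMaybe (carAt P) (block p (len c + r)) ≡ c ∷ mapMaybe (carAt P) (block (p + len c) r)
    read-car {p} {c} r e∈P with len c in len≡ | length-positive c
    ... | suc l | _ = begin
      mapMaybe (carAt P) (p ∷ block (suc p) (l + r))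
        ≡⟨ mapMaybe-∷-just (carAt P) (block (suc p) (l + r)) (carAt-start tr e∈P) ⟩
      c ∷ mapMaybe (carAt P) (block (suc p) (l + r))
        ≡⟨ cong (λ bs → c ∷ mapMaybe (carAt P) bs) (block-++ (suc p) l r) ⟩
      c ∷ mapMaybe (carAt P) (block (suc p) l ++ block (suc p + l) r)
        ≡⟨ cong (c ∷_) (mapMaybe-++ (carAt P) (block (suc p) l) _) ⟩
      c ∷ (mapMaybe (carAt P) (block (suc p) l) ++ mapMaybe (carAt P) (block (suc p + l) r))
        ≡⟨ cong (λ ws → c ∷ (ws ++ mapMaybe (carAt P) (block (suc p + l) r))) (mapMaybe-none (carAt P) interior-empty) ⟩
      c ∷ mapMaybe (carAt P) (block (suc p + l) r)
        ≡⟨ cong (λ b → c ∷ mapMaybe (carAt P) (block b r)) (+-suc p l) ⟨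
      c ∷ mapMaybe (carAt P) (block (p + suc l) r) ∎
      where
      open ≡-Reasoning
      interior-empty : All (λ k → carAt P k ≡ nothing) (block (suc p) l)
      interior-empty = All.tabulate λ {k} k∈ → no-start k (∈-block⁻ k∈)
        where
        no-start : ∀ k → suc p ≤ k × k < suc p + l → carAt P k ≡ nothing
        no-start k (p<k , k<end) with carAt P k in at-k
        ... | nothing = refl
        ... | just d with refl ← trace-disjoint tr (carAt-just⁻ P at-k) e∈P (start∈block k d)
                (subst (λ l′ → k ∈ block p l′) (sym len≡) (∈-block⁺ (<⇒≤ p<k) (subst (k <_) (sym (+-suc p l)) k<end))) =
          ⊥-elim (<-irrefl refl p<k)

    -- Each car read consumes len c ≥ 1 of the k remaining spots, so fuel ≥ k suffices.
    read-layout : ∀ fuel k p → k ≤ fuel → p + k ≡ suc m → StartOrEnd p →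
      Layout P p (mapMaybe (carAt P) (block p k))
    read-layout _ zero p _ p+0≡1+m _ = trans (sym (+-identityʳ p)) p+0≡1+m
    read-layout _ (suc k) p _ p+k≡1+m (inj₁ refl) = ⊥-elim (m+1+n≢m (suc m) p+k≡1+m)
    read-layout (suc fuel) (suc k) p k≤fuel p+k≡1+m (inj₂ (c , e∈P))
      with _ , st , _ ← trace-entry tr e∈P = subst (Layout P p) (sym reading) (e∈P , rest)
      where
      len≤k : len c ≤ suc k
      len≤k = +-cancelˡ-≤ p (len c) (suc k) (subst (p + len c ≤_) (sym p+k≡1+m) (ParksAt.end≤1+m st))
      r = suc k ∸ len c
      k≡len+r : suc k ≡ len c + r
      k≡len+r = sym (m+[n∸m]≡n len≤k)
      reading : mapMaybe (carAt P) (block p (suc k)) ≡ c ∷ mapMaybe (carAt P) (block (p + len c) r)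
      reading = trans (cong (mapMaybe (carAt P) ∘ block p) k≡len+r) (read-car r e∈P)
      rest : Layout P (p + len c) (mapMaybe (carAt P) (block (p + len c) r))
      rest = read-layout fuel r (p + len c) (≤-trans (∸-monoʳ-≤ (suc k) (length-positive c)) (≤-pred k≤fuel))
        (trans (+-assoc p (len c) r) (trans (cong (p +_) (sym k≡len+r)) p+k≡1+m)) (next-start e∈P)

    1-startOrEnd : StartOrEnd 1
    1-startOrEnd with m in m≡
    ... | zero = inj₁ refl
    ... | suc _
      with (b , d) , e∈P , 1∈ ← ∈-occupied⁻ P (occupied-cover ≤-refl (subst (1 ≤_) (sym m≡) (s≤s z≤n)))
      with _ , st , _ ← trace-entry tr e∈P
      with refl ← ≤-antisym (proj₁ (∈-block⁻ 1∈)) (ParksAt.1≤start st) = inj₂ (d , e∈P)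

    outcome-layout : Layout P 1 (outcomeOfStreet m (streetOf P))
    outcome-layout = subst (λ bs → Layout P 1 (mapMaybe (carAt P) bs)) (sym (spots≡block m))
      (read-layout m m 1 ≤-refl refl 1-startOrEnd)

    outcome-unique : Unique (outcomeOfStreet m (streetOf P))
    outcome-unique = layout-unique tr 1 _ outcome-layout

    outcome-complete : ∀ c → c ∈ outcomeOfStreet m (streetOf P)
    outcome-complete c
      with (b , _) , e∈P , refl ← ∈-map⁻ proj₂ (subst (c ∈_) (sym all-parked) (reverse⁺ (∈-allFin c)))
      with _ , st , _ ← trace-entry tr e∈P =
      layout-complete tr 1 _ outcome-layout e∈P (ParksAt.1≤start st)

  outcome-permutation : ∀ x {s} → parkingProcess y x ≡ just s →
    Unique (outcomeOfStreet m s) × (∀ c → c ∈ outcomeOfStreet m s)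
  outcome-permutation x eq with P , refl , tr , all-parked ← process-trace x eq =
    outcome-unique , outcome-complete
    where open Complete tr all-parked

  lenSum : List (Fin n) → ℕ
  lenSum w = sum (map len w)

  lenSum-++ : ∀ u v → lenSum (u ++ v) ≡ lenSum u + lenSum v
  lenSum-++ u v = trans (cong sum (map-++ len u v)) (sum-++ (map len u) (map len v))

  lenSum-∷ʳ : ∀ u c → lenSum (u ++ [ c ]) ≡ lenSum u + len c
  lenSum-∷ʳ u c = trans (lenSum-++ u [ c ]) (cong (lenSum u +_) (+-identityʳ (len c)))

  lenSum-reverse : ∀ u → lenSum (reverse u) ≡ lenSum u
  lenSum-reverse u = sum-↭ (Perm.map⁺ len (↭-reverse u))

  lengthBefore : List (Fin n) → Fin n → ℕ
  lengthBefore [] d = 0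
  lengthBefore (c ∷ w) d = if c ≡ᶠ d then 0 else len c + lengthBefore w d

  lengthBefore-split : ∀ u d v → d ∉ u → lengthBefore (u ++ d ∷ v) d ≡ lenSum u
  lengthBefore-split [] d v _ rewrite to T-≡ (≡ᶠ-refl d) = refl
  lengthBefore-split (c ∷ u) d v d∉ rewrite ≢⇒≡ᶠ-false {c = c} {d} (λ { refl → d∉ (here refl) }) =
    cong (len c +_) (lengthBefore-split u d v (d∉ ∘ there))

  module Arrangement (σ : List (Fin n)) (σ-unique : Unique σ) (σ-complete : ∀ c → c ∈ σ) where

    σ↭allFin : σ ↭ allFin n
    σ↭allFin = ∼bag⇒↭ (unique∧set⇒bag σ-unique (Unique.allFin⁺ n) (λ {c} → mk⇔ (λ _ → ∈-allFin c) (λ _ → σ-complete c)))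

    lenSum-σ : lenSum σ ≡ m
    lenSum-σ = trans (sum-↭ (Perm.map⁺ len σ↭allFin)) (sum-map-lookup-allFin y)

    firstSpot : Fin n → ℕ
    firstSpot d = suc (lengthBefore σ d)

    firstSpot-split : ∀ u d v → σ ≡ u ++ d ∷ v → firstSpot d ≡ suc (lenSum u)
    firstSpot-split u d v σ≡ = cong suc (trans (cong (λ w → lengthBefore w d) σ≡)
      (lengthBefore-split u d v (unique-∷-∉ˡ u (subst Unique σ≡ σ-unique))))

    end≤firstSpot : ∀ u c v d w → σ ≡ u ++ c ∷ v ++ d ∷ w → firstSpot c + len c ≤ firstSpot d
    end≤firstSpot u c v d w σ≡ = begin
      firstSpot c + len c              ≡⟨ cong (_+ len c) (firstSpot-split u c (v ++ d ∷ w) σ≡) ⟩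
      suc (lenSum u + len c)       ≤⟨ s≤s (+-monoʳ-≤ (lenSum u) (m≤m+n (len c) (lenSum v))) ⟩
      suc (lenSum u + lenSum (c ∷ v)) ≡⟨ cong suc (lenSum-++ u (c ∷ v)) ⟨
      suc (lenSum (u ++ c ∷ v))    ≡⟨ firstSpot-split (u ++ c ∷ v) d w (trans σ≡ (sym (++-assoc u (c ∷ v) (d ∷ w)))) ⟨
      firstSpot d                      ∎
      where open ≤-Reasoning

    firstSpot-end≤1+m : ∀ c → firstSpot c + len c ≤ suc m
    firstSpot-end≤1+m c with u , v , σ≡ ← ∈-∃++ (σ-complete c) = begin
      firstSpot c + len c                ≡⟨ cong (_+ len c) (firstSpot-split u c v σ≡) ⟩
      suc (lenSum u + len c)         ≤⟨ s≤s (+-monoʳ-≤ (lenSum u) (m≤m+n (len c) (lenSum v))) ⟩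
      suc (lenSum u + lenSum (c ∷ v)) ≡⟨ cong suc (trans (sym (lenSum-++ u (c ∷ v))) (trans (cong lenSum (sym σ≡)) lenSum-σ)) ⟩
      suc m                          ∎
      where open ≤-Reasoning

    firstSpot≤m : ∀ c → firstSpot c ≤ m
    firstSpot≤m c = ≤-pred (<-≤-trans (m<m+n (firstSpot c) (length-positive c)) (firstSpot-end≤1+m c))

    firstSpot-blocks-disjoint : ∀ {c d k} → k ∈ block (firstSpot c) (len c) → k ∈ block (firstSpot d) (len d) → c ≡ d
    firstSpot-blocks-disjoint {c} {d} k∈c k∈d with c F.≟ d
    ... | yes c≡d = c≡d
    ... | no c≢d with u , v , σ≡ ← ∈-∃++ (σ-complete c) with ∈-++⁻ u (subst (d ∈_) σ≡ (σ-complete d))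
    ...   | inj₂ (here refl) = ⊥-elim (c≢d refl)
    ...   | inj₂ (there d∈v) with v₁ , v₂ , refl ← ∈-∃++ d∈v =
      ⊥-elim (<-irrefl refl (<-≤-trans (proj₂ (∈-block⁻ k∈c)) (≤-trans (end≤firstSpot u c v₁ d v₂ σ≡) (proj₁ (∈-block⁻ k∈d)))))
    ...   | inj₁ d∈u with u₁ , u₂ , refl ← ∈-∃++ d∈u =
      ⊥-elim (<-irrefl refl (<-≤-trans (proj₂ (∈-block⁻ k∈d))
        (≤-trans (end≤firstSpot u₁ d u₂ c v (trans σ≡ (++-assoc u₁ (d ∷ u₂) (c ∷ v)))) (proj₁ (∈-block⁻ k∈c)))))

    firstSpot-blocks-cover : ∀ u v w → σ ≡ u ++ v ++ w → ∀ {k} → suc (lenSum u) ≤ k → k < suc (lenSum u + lenSum v) →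
      ∃[ d ] (d ∈ v × k ∈ block (firstSpot d) (len d))
    firstSpot-blocks-cover u [] w σ≡ {k} u<k k<u+0 =
      ⊥-elim (<-irrefl refl (<-≤-trans (subst (k <_) (cong suc (+-identityʳ _)) k<u+0) u<k))
    firstSpot-blocks-cover u (d ∷ v) w σ≡ {k} u<k k<end with k <? firstSpot d + len d
    ... | yes k<d-end = d , here refl , ∈-block⁺ (subst (_≤ k) (sym (firstSpot-split u d (v ++ w) σ≡)) u<k) k<d-end
    ... | no k≮d-end with firstSpot-blocks-cover (u ++ [ d ]) v w (trans σ≡ (sym (++-assoc u [ d ] (v ++ w))))
          (subst (_≤ k) (trans (cong (_+ len d) (firstSpot-split u d (v ++ w) σ≡)) (cong suc (sym (lenSum-∷ʳ u d)))) (≮⇒≥ k≮d-end))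
          (subst (k <_) (cong suc (trans (sym (+-assoc (lenSum u) (len d) (lenSum v))) (cong (_+ lenSum v) (sym (lenSum-∷ʳ u d))))) k<end)
    ... | d′ , d′∈v , k∈d′ = d′ , there d′∈v , k∈d′

    runWeight : Fin n → ℕ
    runWeight c = lenSum (L σ (position σ c) c)

    lowest : Fin n → ℕ
    lowest c = firstSpot c ∸ runWeight c

    record LeftRun (c : Fin n) : Set where
      field
        outside run after : List (Fin n)
        σ≡ : σ ≡ outside ++ run ++ c ∷ after
        runWeight≡ : runWeight c ≡ lenSum run
        run-smaller : All (F._< c) run
        outside-end : outside ≡ [] ⊎ ∃[ u ] ∃[ e ] (outside ≡ u ++ [ e ] × c F.< e)

    leftRun : ∀ c → LeftRun c
    leftRun c with ∈-∃++ (σ-complete c)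
    ... | u , v , σ≡u++c∷v with takeWhileᵇ-split (_<ᶠ c) (reverse u)
    ... | rest , rev-u≡ , taken , stop = record
      { outside = reverse rest
      ; run = reverse taken-run
      ; after = v
      ; σ≡ = trans σ≡u++c∷v (trans (cong (_++ c ∷ v) u≡) (++-assoc (reverse rest) (reverse taken-run) (c ∷ v)))
      ; runWeight≡ = trans (cong (λ w → lenSum (takeWhileᵇ (_<ᶠ c) (reverse w))) take≡u) (sym (lenSum-reverse taken-run))
      ; run-smaller = All.tabulate (λ {z} z∈ → <ᵇ⇒< (toℕ z) (toℕ c) (All.lookup taken (reverse⁻ z∈)))
      ; outside-end = end stop
      }
      where
      taken-run = takeWhileᵇ (_<ᶠ c) (reverse u)
      c∉u : c ∉ u
      c∉u = unique-∷-∉ˡ u (subst Unique σ≡u++c∷v σ-unique)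
      u≡ : u ≡ reverse rest ++ reverse taken-run
      u≡ = trans (sym (reverse-involutive u)) (trans (cong reverse rev-u≡) (reverse-++ taken-run rest))
      take≡u : take (position σ c) σ ≡ u
      take≡u = trans (cong₂ take (trans (cong (λ w → position w c) σ≡u++c∷v) (position-split u c v c∉u)) σ≡u++c∷v)
                     (take-length-++ u (c ∷ v))
      end : (rest ≡ [] ⊎ ∃[ e ] ∃[ rest′ ] (rest ≡ e ∷ rest′ × ¬ T (e <ᶠ c))) →
        reverse rest ≡ [] ⊎ ∃[ u′ ] ∃[ e ] (reverse rest ≡ u′ ++ [ e ] × c F.< e)
      end (inj₁ refl) = inj₁ refl
      end (inj₂ (e , rest′ , refl , e≮c)) = inj₂ (reverse rest′ , e , unfold-reverse e rest′ , c<e)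
        where
        e∈u : e ∈ u
        e∈u = reverse⁻ (subst (e ∈_) (sym rev-u≡) (∈-++⁺ʳ taken-run (here refl)))
        c<e : c F.< e
        c<e with <-cmp (toℕ c) (toℕ e)
        ... | tri< c<e _ _ = c<e
        ... | tri≈ _ c≡e _ = ⊥-elim (c∉u (subst (_∈ u) (sym (toℕ-injective c≡e)) e∈u))
        ... | tri> _ _ e<c = ⊥-elim (e≮c (<⇒<ᵇ e<c))

    module _ (c : Fin n) where
      open LeftRun (leftRun c)

      firstSpot≡ : firstSpot c ≡ suc (lenSum outside + lenSum run)
      firstSpot≡ = trans (firstSpot-split (outside ++ run) c after (trans σ≡ (sym (++-assoc outside run (c ∷ after)))))
                         (cong suc (lenSum-++ outside run))

      lowest≡ : lowest c ≡ suc (lenSum outside)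
      lowest≡ = trans (cong₂ _∸_ firstSpot≡ runWeight≡) (m+n∸n≡m (suc (lenSum outside)) (lenSum run))

      run-covers : ∀ {k} → lowest c ≤ k → k < firstSpot c → ∃[ d ] (d F.< c × k ∈ block (firstSpot d) (len d))
      run-covers {k} lowest≤k k<first
        with d , d∈run , k∈d ← firstSpot-blocks-cover outside run (c ∷ after) σ≡
               (subst (_≤ k) lowest≡ lowest≤k) (subst (k <_) firstSpot≡ k<first) =
        d , All.lookup run-smaller d∈run , k∈d

      lowest-minimal : ∀ {p} → 1 ≤ p →
        (∀ {k} → p ≤ k → 1 ≤ k → k < firstSpot c → ∃[ d ] (d F.< c × k ∈ block (firstSpot d) (len d))) →
        lowest c ≤ p
      lowest-minimal {p} 1≤p covered with outside-end
      ... | inj₁ outside≡[] = subst (_≤ p) (sym (trans lowest≡ (cong (suc ∘ lenSum) outside≡[]))) 1≤p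
      ... | inj₂ (u , e , outside≡ , c<e) with p ≤? lenSum u + len e
      ...   | no p≰e-end = subst (_≤ p) (sym (trans lowest≡ (cong suc (trans (cong lenSum outside≡) (lenSum-∷ʳ u e)))))
                                 (≰⇒> p≰e-end)
      ...   | yes p≤e-end = ⊥-elim (e-not-covered (covered p≤e-end 1≤e-end e-end<first))
        where
        e-end = lenSum u + len e
        firstSpot-e : firstSpot e ≡ suc (lenSum u)
        firstSpot-e = firstSpot-split u e (run ++ c ∷ after)
          (trans σ≡ (trans (cong (_++ run ++ c ∷ after) outside≡) (++-assoc u [ e ] (run ++ c ∷ after))))
        1≤e-end : 1 ≤ e-end
        1≤e-end = ≤-trans (length-positive e) (m≤n+m (len e) (lenSum u))
        e-end<first : e-end < firstSpot c
        e-end<first = subst (e-end <_) (sym firstSpot≡)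
          (s≤s (subst (_≤ lenSum outside + lenSum run) (trans (cong lenSum outside≡) (lenSum-∷ʳ u e))
                      (m≤m+n (lenSum outside) (lenSum run))))
        e-end∈e : e-end ∈ block (firstSpot e) (len e)
        e-end∈e = ∈-block⁺ (subst (_≤ e-end) (sym firstSpot-e) (subst (_≤ e-end) (+-comm (lenSum u) 1) (+-monoʳ-≤ (lenSum u) (length-positive e))))
                           (subst (e-end <_) (cong (_+ len e) (sym firstSpot-e)) ≤-refl)
        e-not-covered : ¬ (∃[ d ] (d F.< c × e-end ∈ block (firstSpot d) (len d)))
        e-not-covered (d , d<c , e-end∈d) with refl ← firstSpot-blocks-disjoint e-end∈d e-end∈e = <-asym d<c c<e

      admissible : ℕ → Bool
      admissible v = (lowest c ≤ᵇ v) ∧ (v ≤ᵇ firstSpot c)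

      count-admissible : count admissible (spots m) ≡ suc (runWeight c)
      count-admissible = begin
        count admissible (spots m)
          ≡⟨ cong₂ (λ lo hi → count (λ v → (lo ≤ᵇ v) ∧ (v ≤ᵇ hi)) (spots m)) lowest≡ (trans firstSpot≡ (sym (+-suc r t))) ⟩
        count (λ v → (suc r ≤ᵇ v) ∧ (v ≤ᵇ r + suc t)) (spots m)
          ≡⟨ cong (count (λ v → (suc r ≤ᵇ v) ∧ (v ≤ᵇ r + suc t))) (spots≡block m) ⟩
        count (λ v → (suc r ≤ᵇ v) ∧ (v ≤ᵇ r + suc t)) (block 1 m)
          ≡⟨ count-interval r (suc t) m (subst (_≤ m) (trans firstSpot≡ (sym (+-suc r t))) (firstSpot≤m c)) ⟩
        suc t
          ≡⟨ cong suc runWeight≡ ⟨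
        suc (runWeight c) ∎
        where
        open ≡-Reasoning
        r = lenSum outside
        t = lenSum run

    σ-layout : ∀ P → (∀ d → (firstSpot d , d) ∈ P) → Layout P 1 σ
    σ-layout P at-first = go [] σ refl
      where
      go : ∀ u w → σ ≡ u ++ w → Layout P (suc (lenSum u)) w
      go u [] σ≡ = cong suc (trans (cong lenSum (trans (sym (++-identityʳ u)) (sym σ≡))) lenSum-σ)
      go u (d ∷ w) σ≡ =
        subst (λ b → (b , d) ∈ P) (firstSpot-split u d w σ≡) (at-first d) ,
        subst (λ b → Layout P b w) (cong suc (lenSum-∷ʳ u d)) (go (u ++ [ d ]) w (trans σ≡ (sym (++-assoc u [ d ] w))))

    weight-σ : weightFrom y σ 0 σ ≡ product (map (λ c → suc (runWeight c)) (allFin n))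
    weight-σ = trans (go [] σ refl) (product-↭ (Perm.map⁺ (λ c → suc (runWeight c)) σ↭allFin))
      where
      go : ∀ u w → σ ≡ u ++ w → weightFrom y σ (length u) w ≡ product (map (λ c → suc (runWeight c)) w)
      go u [] _ = refl
      go u (c ∷ w) σ≡ = cong₂ _*_
        (cong (λ i → suc (lenSum (L σ i c))) (sym (trans (cong (λ v → position v c) σ≡)
          (position-split u c w (unique-∷-∉ˡ u (subst Unique σ≡ σ-unique))))))
        (trans (cong (λ i → weightFrom y σ i w) (sym (trans (length-++ u) (+-comm (length u) 1))))
               (go (u ++ [ c ]) w (trans σ≡ (sym (++-assoc u [ c ] w)))))

    atFirstSpots : List (Fin n) → List Entry
    atFirstSpots = map (λ c → (firstSpot c , c))

    firstSpot-block-free : ∀ D c → All (F._< c) D → ∀ {k} → k ∈ block (firstSpot c) (len c) → k ∉ occupied (atFirstSpots D)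
    firstSpot-block-free D c D<c k∈c k∈occ
      with e , e∈ , k∈e ← ∈-occupied⁻ (atFirstSpots D) k∈occ
      with d , d∈D , refl ← ∈-map⁻ (λ c → (firstSpot c , c)) e∈
      with refl ← firstSpot-blocks-disjoint k∈c k∈e = <-irrefl refl (All.lookup D<c d∈D)

    blockFree-atFirstSpots : ∀ D c → All (F._< c) D →
      T (blockFree m (streetOf (atFirstSpots D)) (block (firstSpot c) (len c)))
    blockFree-atFirstSpots D c D<c = all⁻ _ (All.tabulate λ k∈c →
      from T-∧ ( ≤⇒≤ᵇ (≤-pred (<-≤-trans (proj₂ (∈-block⁻ k∈c)) (firstSpot-end≤1+m c)))
               , ¬T⇒T-not (firstSpot-block-free D c D<c k∈c ∘ isOccupied⇒∈ (atFirstSpots D))))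

    firstEmpty-atFirstSpots : ∀ D c p → T (admissible c p) → All (F._< c) D → (∀ {d} → d F.< c → d ∈ D) →
      firstEmpty m (streetOf (atFirstSpots D)) p ≡ just (firstSpot c)
    firstEmpty-atFirstSpots D c p adm D<c smaller∈D = firstEmpty-just⁺ (streetOf (atFirstSpots D)) p (s≤s (firstSpot≤m c))
      ( s≤s z≤n
      , from T-∧ (≤⇒≤ᵇ p≤first , ¬T⇒T-not (firstSpot-block-free D c D<c (start∈block (firstSpot c) c) ∘ isOccupied⇒∈ (atFirstSpots D)))
      , earlier )
      where
      p≤first : p ≤ firstSpot c
      p≤first = ≤ᵇ⇒≤ p (firstSpot c) (proj₂ (to T-∧ adm))
      earlier : ∀ {i} → 1 ≤ i → i < firstSpot c → ¬ T (freeFrom p (streetOf (atFirstSpots D)) i)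
      earlier {i} _ i<first free
        with d , d<c , i∈d ← run-covers c (≤-trans (≤ᵇ⇒≤ (lowest c) p (proj₁ (to T-∧ adm))) (≤ᵇ⇒≤ p i (proj₁ (to T-∧ free)))) i<first =
        T-not⇒¬T (proj₂ (to T-∧ free)) (∈⇒T-any-≡ᵇ (∈-occupied⁺ (∈-map⁺ (λ c → (firstSpot c , c)) (smaller∈D d<c)) i∈d))

    run-atFirstSpots : ∀ x → (∀ c → T (admissible c (lookup x c))) → ∀ D cs → Increasing cs →
      (∀ d → d ∈ D ⊎ d ∈ cs) → All (λ d → All (d F.<_) cs) D →
      runCars m y x cs (streetOf (atFirstSpots D)) ≡ just (streetOf (atFirstSpots (cs ʳ++ D)))
    run-atFirstSpots x adm D [] _ _ _ = refl
    run-atFirstSpots x adm D (c ∷ cs) (c<cs ∷ inc) every D<cs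
      with parkCar m c (len c) (lookup x c) (streetOf (atFirstSpots D))
         | parkCar-just⁺ c (len c) (lookup x c) (streetOf (atFirstSpots D))
             (firstEmpty-atFirstSpots D c (lookup x c) (adm c) (All.map All.head D<cs) (smaller⇒done every c<cs))
             (blockFree-atFirstSpots D c (All.map All.head D<cs))
    ... | _ | refl =
      run-atFirstSpots x adm (c ∷ D) cs inc every′ (c<cs ∷ All.map All.tail D<cs)
      where
      every′ : ∀ d → d ∈ c ∷ D ⊎ d ∈ cs
      every′ d with every d
      ... | inj₁ d∈D = inj₁ (there d∈D)
      ... | inj₂ (here refl) = inj₁ (here refl)
      ... | inj₂ (there d∈cs) = inj₂ d∈cs

    finalStreet : Street n
    finalStreet = streetOf (atFirstSpots (reverse (allFin n)))

    admissible⇒process : ∀ x → (∀ c → T (admissible c (lookup x c))) → parkingProcess y x ≡ just finalStreet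
    admissible⇒process x adm =
      run-atFirstSpots x adm [] (allFin n) (allFin-increasing n) (λ d → inj₂ (∈-allFin d)) []

    admissible⇒outcome : ∀ x → (∀ c → T (admissible c (lookup x c))) → outcomeOfStreet m finalStreet ≡ σ
    admissible⇒outcome x adm with process-trace x (admissible⇒process x adm)
    ... | P , refl , tr , all-parked = layout-deterministic tr 1 _ σ outcome-layout (σ-layout P at-first)
      where
      open Complete tr all-parked
      at-first : ∀ d → (firstSpot d , d) ∈ P
      at-first d = ∈-map⁺ (λ c → (firstSpot c , c)) (reverse⁺ (∈-allFin d))

    outcome⇒admissible : ∀ x {s} → (∀ c → 1 ≤ lookup x c) → parkingProcess y x ≡ just s → outcomeOfStreet m s ≡ σ →
      ∀ c → T (admissible c (lookup x c))
    outcome⇒admissible x x≥1 eq outcome≡σ with process-trace x eq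
    ... | P , refl , tr , all-parked = admissible-at
      where
      open Complete tr all-parked
      at-first : ∀ d → (firstSpot d , d) ∈ P
      at-first d with u , v , σ≡ , e∈P ← layout-position tr 1 σ (subst (Layout P 1) outcome≡σ outcome-layout) (σ-complete d) =
        subst (λ b → (b , d) ∈ P) (sym (firstSpot-split u d v σ≡)) e∈P
      admissible-at : ∀ c → T (admissible c (lookup x c))
      admissible-at c with trace-entry tr (at-first c)
      ... | Q , st , Q⊆P = from T-∧ (≤⇒≤ᵇ (lowest-minimal c (x≥1 c) covered) , ≤⇒≤ᵇ (ParksAt.pref≤start st))
        where
        covered : ∀ {k} → lookup x c ≤ k → 1 ≤ k → k < firstSpot c → ∃[ d ] (d F.< c × k ∈ block (firstSpot d) (len d))
        covered {k} x≤k 1≤k k<first with ∈-occupied⁻ Q (ParksAt.passed-occupied st x≤k 1≤k k<first)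
        ... | (b , d) , e∈Q , k∈e =
          d , All.lookup (ParksAt.after-smaller st) e∈Q ,
          subst (λ b → k ∈ block b (len d)) (trace-start-unique tr (Q⊆P e∈Q) (at-first d)) k∈e

  isParkingSequence-just : ∀ {x s} → parkingProcess y x ≡ just s → isParkingSequence y x ≡ true
  isParkingSequence-just eq rewrite eq = refl

  hasOutcome-just : ∀ σ {x s} → parkingProcess y x ≡ just s → hasOutcome y σ x ≡ eqWord (outcomeOfStreet m s) (V.toList σ)
  hasOutcome-just σ eq rewrite eq = refl

  isParkingSequence-true : ∀ x → T (isParkingSequence y x) → ∃[ s ] (parkingProcess y x ≡ just s)
  isParkingSequence-true x _ with parkingProcess y x
  ... | just s = s , refl

  hasOutcome-true : ∀ σ x → T (hasOutcome y σ x) →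
    ∃[ s ] (parkingProcess y x ≡ just s × T (eqWord (outcomeOfStreet m s) (V.toList σ)))
  hasOutcome-true σ x t with parkingProcess y x
  ... | just s = s , refl , t

  count-outcomes : ∀ {x} → T (isParkingSequence y x) → count (λ σ → hasOutcome y σ x) (permutations n) ≡ 1
  count-outcomes {x} isPS with isParkingSequence-true x isPS
  ... | s , eq = begin
    count (λ σ → hasOutcome y σ x) (filterᵇ isPermutation (vecsOver (allFin n) n))
      ≡⟨ cong length (filterᵇ-filterᵇ isPermutation (λ σ → hasOutcome y σ x) (vecsOver (allFin n) n)) ⟩
    count (λ σ → isPermutation σ ∧ hasOutcome y σ x) (vecsOver (allFin n) n)
      ≡⟨ cong length (filterᵇ-cong-∈ (vecsOver (allFin n) n) (λ {σ} _ → permutation-with-outcome σ)) ⟩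
    count (λ σ → eqWord w (V.toList σ)) (vecsOver (allFin n) n)
      ≡⟨ count-eqWord-vecsOver n w (complete-unique⇒length w w-unique w-complete) ⟩
    1 ∎
    where
    open ≡-Reasoning
    isPermutation = λ (σ : Vec (Fin n) n) → distinct (V.toList σ)
    w = outcomeOfStreet m s
    w-unique = proj₁ (outcome-permutation x eq)
    w-complete = proj₂ (outcome-permutation x eq)
    permutation-with-outcome : ∀ σ → (isPermutation σ ∧ hasOutcome y σ x) ≡ eqWord w (V.toList σ)
    permutation-with-outcome σ rewrite hasOutcome-just σ eq with eqWord w (V.toList σ) in match
    ... | true = cong (_∧ true) (to T-≡ (subst (T ∘ distinct) (T-eqWord⇒≡ w (V.toList σ) (from T-≡ match)) (Unique⇒T-distinct w-unique)))
    ... | false = ∧-zeroʳ (isPermutation σ)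

  preference≥1 : ∀ {x} → x ∈ preferenceLists y → ∀ c → 1 ≤ lookup x c
  preference≥1 {x} x∈ c = proj₁ (∈-block⁻ (subst (lookup x c ∈_) (spots≡block m) (∈-vecsOver⁻ (spots m) n x∈ c)))

  fiber-length : ∀ σ → T (distinct (V.toList σ)) → length (outcomeFiber y σ) ≡ weight y σ
  fiber-length σ σ-perm = begin
    length (filterᵇ (hasOutcome y σ) (filterᵇ (isParkingSequence y) (preferenceLists y)))
      ≡⟨ cong length (filterᵇ-filterᵇ (isParkingSequence y) (hasOutcome y σ) (preferenceLists y)) ⟩
    count (λ x → isParkingSequence y x ∧ hasOutcome y σ x) (preferenceLists y)
      ≡⟨ cong length (filterᵇ-cong-∈ (preferenceLists y) in-fiber≡admissible) ⟩
    count (pointwise admissible) (vecsOver (spots m) n)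
      ≡⟨ count-pointwise-vecsOver (spots m) n admissible ⟩
    product (tabulate (λ c → count (admissible c) (spots m)))
      ≡⟨ cong product (trans (sym (map-tabulate (λ i → i) (λ c → count (admissible c) (spots m))))
                             (map-cong count-admissible (allFin n))) ⟩
    product (map (λ c → suc (runWeight c)) (allFin n))
      ≡⟨ weight-σ ⟨
    weight y σ ∎
    where
    open ≡-Reasoning
    σ-unique = T-distinct⇒Unique (V.toList σ) σ-perm
    open Arrangement (V.toList σ) σ-unique (unique-length⇒complete (V.toList σ) σ-unique (length-toList σ))
    in-fiber≡admissible : ∀ {x} → x ∈ preferenceLists y → (isParkingSequence y x ∧ hasOutcome y σ x) ≡ pointwise admissible x
    in-fiber≡admissible {x} x∈ with pointwise admissible x in adm
    ... | true = cong₂ _∧_ (isParkingSequence-just (admissible⇒process x adm′))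
      (trans (hasOutcome-just σ (admissible⇒process x adm′))
             (to T-≡ (subst (λ w → T (eqWord w (V.toList σ))) (sym (admissible⇒outcome x adm′)) (eqWord-refl (V.toList σ)))))
      where
      adm′ = T-pointwise⁻ admissible x (from T-≡ adm)
    ... | false with hasOutcome y σ x in has
    ...   | false = ∧-zeroʳ (isParkingSequence y x)
    ...   | true with hasOutcome-true σ x (from T-≡ has)
    ...     | s , eq , match = ⊥-elim (subst T adm (T-pointwise⁺ admissible x
                (outcome⇒admissible x (preference≥1 x∈) eq (T-eqWord⇒≡ (outcomeOfStreet m s) (V.toList σ) match))))

  length-PS≡sum-fibers : length (PS y) ≡ sum (map (λ σ → length (outcomeFiber y σ)) (permutations n))
  length-PS≡sum-fibers = sym (begin
    sum (map (λ σ → count (hasOutcome y σ) (PS y)) (permutations n))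
      ≡⟨ sum-count-swap (λ σ x → hasOutcome y σ x) (permutations n) (PS y) ⟩
    sum (map (λ x → count (λ σ → hasOutcome y σ x) (permutations n)) (PS y))
      ≡⟨ sum-map-≡1 _ (PS y) (λ x∈ → count-outcomes (proj₂ (∈-filter⁻ (T? ∘ isParkingSequence y) {xs = preferenceLists y} x∈))) ⟩
    length (PS y) ∎)
    where open ≡-Reasoning

  sum-fibers≡sum-weights : sum (map (λ σ → length (outcomeFiber y σ)) (permutations n)) ≡ sum (map (weight y) (permutations n))
  sum-fibers≡sum-weights = cong sum (map-cong-local {xs = permutations n} (All.tabulate λ {σ} σ∈ →
    fiber-length σ (proj₂ (∈-filter⁻ (T? ∘ (distinct ∘ V.toList)) {xs = vecsOver (allFin n) n} σ∈))))

corollary1p2 : (n : ℕ) (y : Vec ℕ n) → (∀ (i : Fin n) → 1 ≤ lookup y i) →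
    (length (PS y) ≡ sum (map (λ σ → length (outcomeFiber y σ)) (permutations n)))
    × (sum (map (λ σ → length (outcomeFiber y σ)) (permutations n))
        ≡ sum (map (weight y) (permutations n)))
corollary1p2 n y length-positive = length-PS≡sum-fibers , sum-fibers≡sum-weights
  where open Parking n y length-positive
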